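{- For every integer $n \ge 2$ there exists a graceful sequence $0 = x_1 < x_2 < \dots < x_n$ of $n$ integers with $x_n \le \frac{(n-1)\left((n-1)^2+1\right)}{2}$. Equivalently, the length of an optimal Golomb ruler with $n$ marks is at most $\frac{(n-1)\left((n-1)^2+1\right)}{2}$.
   Context: A sequence of integers $0 = x_1 < x_2 < \dots < x_n$ is called a graceful sequence if all pairwise differences are distinct: whenever $|x_i - x_j| = |x_p - x_q|$ with $i \neq j$ and $p \neq q$, we have $\{i,j\} = \{p,q\}$. A Golomb ruler with $n$ marks is such a sequence, its length is $x_n$, and an optimal Golomb ruler is one of minimum length $x_n$ for the given $n$. -}

module Defs where

open import Data.Nat using (ℕ; zero; suc; _+_; _*_; _∸_; _^_; _≤_; _<_)
open import Data.Fin using (Fin; toℕ)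
open import Data.Product using (_×_)
open import Relation.Binary.PropositionalEquality using (_≡_)

-- A sequence x_1, ..., x_n is modelled as x : Fin n → ℕ (index i ↦ x_{i+1}).

StrictlyIncreasing : {n : ℕ} → (Fin n → ℕ) → Set
StrictlyIncreasing {n} x = (i j : Fin n) → toℕ i < toℕ j → x i < x j

-- Graceful (all pairwise differences distinct): for i < j and p < q,
-- if x_j - x_i = x_q - x_p then {i,j} = {p,q}.  (Since the sequence is
-- increasing, every difference |x_i - x_j| with i ≠ j is x_max - x_min of
-- an ordered pair; the unordered pairs coincide iff i = p and j = q.)
Graceful : {n : ℕ} → (Fin n → ℕ) → Set
Graceful {n} x = (i j p q : Fin n) → toℕ i < toℕ j → toℕ p < toℕ q →
  x j ∸ x i ≡ x q ∸ x p → (i ≡ p × j ≡ q)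

module Submission where

-- Write T k = 0 + 1 + … + (k - 1) for the triangular numbers and fix any
-- modulus M > T N.  The marks are  x_i = i·M - T i  (0 ≤ i ≤ N), built
-- recursively as partial sums of M, M - 1, M - 2, ….  Since
-- T (a + d) = T a + a·d + T d, the difference of two marks is
--     x_{a+d} - x_a = d·M - (a·d + T d),   with  0 ≤ a·d + T d ≤ T N < M,
-- so it is a "ceiling representation" of the difference: the gap d is the
-- ceiling of (x_{a+d} - x_a) / M, hence determined by the difference, and
-- then so is the offset a·d + T d, which determines a.  Thus all
-- differences are distinct, and the marks increase because d ≥ 1 forces a
-- positive difference.  With the least admissible modulus M = T N + 1 the
-- last mark is  x_N = N·(T N + 1) - T N,  and 2·x_N ≤ N (N² + 1) is a
-- polynomial inequality.

open import Defs
open import Data.Nat using (ℕ; zero; suc; _+_; _*_; _∸_; _^_; _≤_; _<_)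
open import Data.Fin using (Fin; fromℕ)
open import Data.Product using (Σ; _×_)
open import Relation.Binary.PropositionalEquality using (_≡_)

open import Data.Nat using (z≤n; s≤s)
open import Data.Nat.Properties
open import Data.Nat.Tactic.RingSolver using (solve-∀)
open import Data.Fin using (toℕ)
open import Data.Fin.Properties using (toℕ<n; toℕ-fromℕ; toℕ-injective)
open import Data.Product using (_,_)
open import Data.Empty using (⊥; ⊥-elim)
open import Relation.Binary.Definitions using (tri<; tri≈; tri>)
open import Relation.Binary.PropositionalEquality
  using (refl; sym; trans; cong; cong₂; subst; module ≡-Reasoning)

T : ℕ → ℕ
T zero    = 0
T (suc k) = T k + k

-- Splitting a triangle of side a + d into two triangles and an a × d block.
T-+ : ∀ a d → T (a + d) ≡ T a + (a * d + T d)
T-+ a zero rewrite +-identityʳ a | *-zeroʳ a = sym (+-identityʳ (T a))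
T-+ a (suc d) rewrite +-suc a d = begin
    T (a + d) + (a + d)             ≡⟨ cong (_+ (a + d)) (T-+ a d) ⟩
    T a + (a * d + T d) + (a + d)   ≡⟨ regroup (T a) (T d) a d ⟩
    T a + (a * suc d + (T d + d))   ∎
  where
  open ≡-Reasoning
  regroup : ∀ ta td a d → ta + (a * d + td) + (a + d) ≡ ta + (a * suc d + (td + d))
  regroup = solve-∀

T-mono : ∀ {k l} → k ≤ l → T k ≤ T l
T-mono z≤n       = z≤n
T-mono (s≤s k≤l) = +-mono-≤ (T-mono k≤l) k≤l

k≤1+T : ∀ k → k ≤ suc (T k)
k≤1+T zero    = z≤n
k≤1+T (suc k) = s≤s (m≤n+m k (T k))

twice-T : ∀ k → 2 * T (suc k) ≡ suc k * k
twice-T zero    = refl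
twice-T (suc k) = begin
    2 * (T (suc k) + suc k)       ≡⟨ *-distribˡ-+ 2 (T (suc k)) (suc k) ⟩
    2 * T (suc k) + 2 * suc k     ≡⟨ cong (_+ 2 * suc k) (twice-T k) ⟩
    suc k * k + 2 * suc k         ≡⟨ square k ⟩
    suc (suc k) * suc k           ∎
  where
  open ≡-Reasoning
  square : ∀ k → suc k * k + 2 * suc k ≡ suc (suc k) * suc k
  square = solve-∀

ceiling-separated : ∀ {M v d e E F} → d < e → F < M →
                    v + E ≡ d * M → v + F ≡ e * M → ⊥
ceiling-separated {M} {v} {d} {e} {E} {F} d<e F<M vE vF = <-irrefl refl (begin-strict
    v + F       <⟨ +-monoʳ-< v F<M ⟩
    v + M       ≤⟨ +-monoˡ-≤ M (m≤m+n v E) ⟩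
    v + E + M   ≡⟨ cong (_+ M) vE ⟩
    d * M + M   ≡⟨ +-comm (d * M) M ⟩
    suc d * M   ≤⟨ *-monoˡ-≤ M d<e ⟩
    e * M       ≡⟨ sym vF ⟩
    v + F       ∎)
  where open ≤-Reasoning

ceiling-unique : ∀ {M v d e E F} → E < M → F < M →
                 v + E ≡ d * M → v + F ≡ e * M → d ≡ e
ceiling-unique {d = d} {e} E<M F<M vE vF with <-cmp d e
... | tri< d<e _ _ = ⊥-elim (ceiling-separated d<e F<M vE vF)
... | tri≈ _ d≡e _ = d≡e
... | tri> _ _ e<d = ⊥-elim (ceiling-separated e<d E<M vF vE)

ceiling-positive : ∀ {M v d E} → E < M → v + E ≡ suc d * M → 0 < v
ceiling-positive {v = suc v} E<M vE = s≤s z≤n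
ceiling-positive {M} {zero} {d} {E} E<M vE =
  ⊥-elim (<-irrefl refl (<-≤-trans E<M (subst (M ≤_) (sym vE) (m≤m+n M (d * M)))))

data Gap : ℕ → ℕ → Set where
  gap : ∀ a d → Gap a (a + suc d)

gap-view : ∀ {i j} → i < j → Gap i j
gap-view {zero}  (s≤s _) = gap 0 _
gap-view {suc i} (s≤s i<j) with gap-view i<j
... | gap .i d = gap (suc i) d

module Ruler {N M : ℕ} (TN<M : T N < M) where

  marks : ℕ → ℕ
  marks zero    = 0
  marks (suc i) = marks i + (M ∸ i)

  N≤M : N ≤ M
  N≤M = ≤-trans (k≤1+T N) TN<M

  marks-mono : ∀ a d → marks a ≤ marks (a + d)
  marks-mono a zero rewrite +-identityʳ a = ≤-refl
  marks-mono a (suc d) rewrite +-suc a d = ≤-trans (marks-mono a d) (m≤m+n _ _)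

  marks-closed : ∀ i → i ≤ M → marks i + T i ≡ i * M
  marks-closed zero    _     = refl
  marks-closed (suc i) i<M = begin
      marks i + (M ∸ i) + (T i + i)     ≡⟨ swap (marks i) (M ∸ i) (T i) i ⟩
      (marks i + T i) + ((M ∸ i) + i)   ≡⟨ cong₂ _+_ (marks-closed i (<⇒≤ i<M)) (m∸n+n≡m (<⇒≤ i<M)) ⟩
      i * M + M                         ≡⟨ +-comm (i * M) M ⟩
      suc i * M                         ∎
    where
    open ≡-Reasoning
    swap : ∀ x y z w → x + y + (z + w) ≡ (x + z) + (y + w)
    swap = solve-∀

  offset<M : ∀ a d → a + d ≤ N → a * d + T d < M
  offset<M a d a+d≤N = ≤-<-trans offset≤TN TN<M
    where
    offset≤TN : a * d + T d ≤ T N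
    offset≤TN = ≤-trans (m≤n+m _ (T a)) (≤-trans (≤-reflexive (sym (T-+ a d))) (T-mono a+d≤N))

  difference : ∀ a d → a + d ≤ N →
               (marks (a + d) ∸ marks a) + (a * d + T d) ≡ d * M
  difference a d a+d≤N = +-cancelˡ-≡ (marks a) _ _ (+-cancelʳ-≡ (T a) _ _ (begin
      marks a + ((marks (a + d) ∸ marks a) + (a * d + T d)) + T a
        ≡⟨ cong (_+ T a) (sym (+-assoc (marks a) _ _)) ⟩
      marks a + (marks (a + d) ∸ marks a) + (a * d + T d) + T a
        ≡⟨ cong (λ y → y + (a * d + T d) + T a) (m+[n∸m]≡n (marks-mono a d)) ⟩
      marks (a + d) + (a * d + T d) + T a
        ≡⟨ +-assoc (marks (a + d)) _ (T a) ⟩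
      marks (a + d) + ((a * d + T d) + T a)
        ≡⟨ cong (marks (a + d) +_) (trans (+-comm _ (T a)) (sym (T-+ a d))) ⟩
      marks (a + d) + T (a + d)
        ≡⟨ marks-closed (a + d) (≤-trans a+d≤N N≤M) ⟩
      (a + d) * M
        ≡⟨ *-distribʳ-+ M a d ⟩
      a * M + d * M
        ≡⟨ cong (_+ d * M) (sym (marks-closed a (≤-trans (m≤m+n a d) (≤-trans a+d≤N N≤M)))) ⟩
      marks a + T a + d * M
        ≡⟨ +-assoc (marks a) (T a) (d * M) ⟩
      marks a + (T a + d * M)
        ≡⟨ cong (marks a +_) (+-comm (T a) (d * M)) ⟩
      marks a + (d * M + T a)
        ≡⟨ sym (+-assoc (marks a) (d * M) (T a)) ⟩
      marks a + d * M + T a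
        ∎))
    where open ≡-Reasoning

  marks-increasing : ∀ {i j} → i < j → j ≤ N → marks i < marks j
  marks-increasing i<j j≤N with gap-view i<j
  ... | gap a d = subst (marks a <_) (m+[n∸m]≡n (marks-mono a (suc d))) (m<m+n (marks a) 0<difference)
    where
    0<difference : 0 < marks (a + suc d) ∸ marks a
    0<difference = ceiling-positive {d = d} (offset<M a (suc d) j≤N) (difference a (suc d) j≤N)

  -- Equal differences have equal gaps (ceiling uniqueness), hence equal
  -- offsets a·d + T d, hence equal starting points.
  same-difference : ∀ a d b e → a + suc d ≤ N → b + suc e ≤ N →
                    marks (a + suc d) ∸ marks a ≡ marks (b + suc e) ∸ marks b →
                    a ≡ b × d ≡ e
  same-difference a d b e a+d≤N b+e≤N same = a≡b , d≡e
    where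
    v : ℕ
    v = marks (a + suc d) ∸ marks a

    diff-a : v + (a * suc d + T (suc d)) ≡ suc d * M
    diff-a = difference a (suc d) a+d≤N

    diff-b : v + (b * suc e + T (suc e)) ≡ suc e * M
    diff-b = trans (cong (_+ (b * suc e + T (suc e))) same) (difference b (suc e) b+e≤N)

    gaps-equal : suc d ≡ suc e
    gaps-equal = ceiling-unique {v = v} (offset<M a (suc d) a+d≤N) (offset<M b (suc e) b+e≤N) diff-a diff-b

    d≡e : d ≡ e
    d≡e = suc-injective gaps-equal

    offsets-equal : a * suc d + T (suc d) ≡ b * suc e + T (suc e)
    offsets-equal = +-cancelˡ-≡ v _ _ (trans diff-a (trans (cong (_* M) gaps-equal) (sym diff-b)))

    a≡b : a ≡ b
    a≡b = *-cancelʳ-≡ a b (suc d) (+-cancelʳ-≡ (T (suc d)) _ _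
            (subst (λ k → a * suc d + T (suc d) ≡ b * suc k + T (suc k)) (sym d≡e) offsets-equal))

  marks-graceful : ∀ {i j p q} → i < j → j ≤ N → p < q → q ≤ N →
                   marks j ∸ marks i ≡ marks q ∸ marks p → i ≡ p × j ≡ q
  marks-graceful i<j j≤N p<q q≤N same with gap-view i<j | gap-view p<q
  ... | gap a d | gap b e with same-difference a d b e j≤N q≤N same
  ... | a≡b , d≡e = a≡b , cong₂ _+_ a≡b (cong suc d≡e)

-- The polynomial identity behind the length bound, with n = k + 1:
-- n (n² + 1) + n k = n (n k) + 2 n + 2 k n  (n² written as n · n · 1, the
-- unfolding of n ^ 2, which the ring solver does not parse).
cubic : ∀ k → suc k * (suc k * k) + 2 * suc k + 2 * k * suc k ≡ suc k * (suc k * (suc k * 1) + 1) + suc k * k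
cubic = solve-∀

ruler-length : ∀ m → 2 * Ruler.marks {suc m} {suc (T (suc m))} ≤-refl (suc m)
                     ≤ suc m * (suc m ^ 2 + 1)
ruler-length m = +-cancelʳ-≤ (n * m) (2 * x) _ (begin
    2 * x + n * m                       ≡⟨ cong (2 * x +_) (sym (twice-T m)) ⟩
    2 * x + 2 * t                       ≡⟨ sym (*-distribˡ-+ 2 x t) ⟩
    2 * (x + t)                         ≡⟨ cong (2 *_) closed ⟩
    2 * (n * suc t)                     ≡⟨ expand m t ⟩
    n * (2 * t) + 2 * n                 ≡⟨ cong (λ y → n * y + 2 * n) (twice-T m) ⟩
    n * (n * m) + 2 * n                 ≤⟨ m≤m+n _ (2 * m * n) ⟩
    n * (n * m) + 2 * n + 2 * m * n     ≡⟨ cubic m ⟩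
    n * (n ^ 2 + 1) + n * m             ∎)
  where
  n : ℕ
  n = suc m
  t : ℕ
  t = T n
  open Ruler {n} {suc t} ≤-refl
  x : ℕ
  x = marks n
  closed : x + t ≡ n * suc t
  closed = marks-closed n (k≤1+T n)
  open ≤-Reasoning
  expand : ∀ k s → 2 * (suc k * suc s) ≡ suc k * (2 * s) + 2 * suc k
  expand = solve-∀

theorem1 : (m : ℕ) → Σ (Fin (suc (suc m)) → ℕ) (λ x → (x Fin.zero ≡ 0) × StrictlyIncreasing x × Graceful x × (2 * x (fromℕ (suc m)) ≤ (suc m) * ((suc m) ^ 2 + 1)))
theorem1 m = x , refl , increasing , graceful , length
  where
  open Ruler {suc m} {suc (T (suc m))} ≤-refl

  x : Fin (suc (suc m)) → ℕ
  x i = marks (toℕ i)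

  in-range : (i : Fin (suc (suc m))) → toℕ i ≤ suc m
  in-range i = ≤-pred (toℕ<n i)

  increasing : StrictlyIncreasing x
  increasing i j i<j = marks-increasing i<j (in-range j)

  graceful : Graceful x
  graceful i j p q i<j p<q same with marks-graceful i<j (in-range j) p<q (in-range q) same
  ... | i≡p , j≡q = toℕ-injective i≡p , toℕ-injective j≡q

  length : 2 * x (fromℕ (suc m)) ≤ suc m * (suc m ^ 2 + 1)
  length = subst (λ k → 2 * marks k ≤ suc m * (suc m ^ 2 + 1)) (sym (toℕ-fromℕ (suc m))) (ruler-length m)
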